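{- Let $U_1=\{12,1\overline{2},\overline{1}2,\overline{1}\,\overline{2}\}$, $U_2=\{12,1\overline{2},\overline{1}2,21\}$, $U_3=\{12,1\overline{2},\overline{1}2,2\overline{1}\}$, $U_4=\{12,1\overline{2},\overline{1}2,\overline{2}\,\overline{1}\}$, $U_5=\{12,1\overline{2},\overline{1}\,\overline{2},21\}$, $U_6=\{12,1\overline{2},\overline{1}\,\overline{2},2\overline{1}\}$, $U_7=\{12,1\overline{2},\overline{1}\,\overline{2},\overline{2}1\}$, $U_8=\{12,1\overline{2},21,2\overline{1}\}$, $U_9=\{12,1\overline{2},21,\overline{2}1\}$, $U_{10}=\{12,1\overline{2},21,\overline{2}\,\overline{1}\}$, $U_{11}=\{12,1\overline{2},2\overline{1},\overline{2}1\}$, $U_{12}=\{12,1\overline{2},2\overline{1},\overline{2}\,\overline{1}\}$, $U_{13}=\{12,1\overline{2},\overline{2}1,\overline{2}\,\overline{1}\}$, $U_{14}=\{12,\overline{1}\,\overline{2},21,\overline{2}\,\overline{1}\}$, $U_{15}=\{12,\overline{1}\,\overline{2},2\overline{1},\overline{2}1\}$ and $U_{16}=\{1\overline{2},\overline{1}2,2\overline{1},\overline{2}1\}$. Then for every $n\ge 3$: \begin{itemize} \item $b_n(U_{14})=0$; \item $b_n(U_{10})=b_n(U_{15})=2n$; \item $b_n(U_4)=b_n(U_5)=1+\binom{n+1}{2}$; \item $b_n(U_1)=b_n(U_6)=b_n(U_7)=b_n(U_{12})=b_n(U_{13})=2^n$; \item $b_n(U_8)=b_n(U_9)=b_n(U_{16})=2\cdot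 n!$; \item $b_n(U_3)=b_n(U_{11})=\sum_{j=0}^n j!$; \item $b_n(U_2)=n!+\sum_{j=0}^{n-1}j!\,(n-1-j)!$. \end{itemize}
   Context: A signed permutation of length $n$ is a word $\alpha=\alpha_1\cdots\alpha_n$ in which each of the symbols $1,\dots,n$ appears exactly once, each occurrence possibly barred (written $\overline{i}$). The set of all of them is $B_n$. For a symbol $x$, $|x|$ denotes the underlying number with any bar removed. For $\tau=\tau_1\cdots\tau_k\in B_k$ and $\alpha\in B_n$, $\alpha$ contains $\tau$ if there are indices $1\le i_1<\cdots<i_k\le n$ such that (1) $|\alpha_{i_p}|>|\alpha_{i_q}|$ if and only if $|\tau_p|>|\tau_q|$ for all $p,q$, and (2) $\alpha_{i_j}$ is barred if and only if $\tau_j$ is barred for every $j$. Otherwise $\alpha$ avoids $\tau$. $B_n(T)$ is the set of $\alpha\in B_n$ avoiding every pattern in $T$, and $b_n(T)=|B_n(T)|$. -}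

module Defs where

open import Data.Nat using (ℕ; zero; suc; _+_; _*_; _∸_; _<_)
open import Data.Nat using (_!)
open import Data.Fin using (Fin; toℕ) renaming (_<_ to _<ᶠ_)
open import Data.Bool using (Bool; true; false)
open import Data.Product using (_×_; _,_; proj₁; proj₂; Σ-syntax)
open import Data.Vec using (Vec; lookup; map; []; _∷_)
open import Data.List using (List; length; upTo)
import Data.List as L
open import Data.List.Relation.Unary.Unique.Propositional using (Unique)
open import Data.List.Membership.Propositional using (_∈_)
open import Relation.Nullary using (¬_)
open import Relation.Binary.PropositionalEquality using (_≡_)
open import Function using (_⇔_)

-- A signed letter: underlying value in Fin n (value i stands for i+1),
-- and a flag, true = barred.
SLetter : ℕ → Set
SLetter n = Fin n × Bool

SWord : ℕ → Set
SWord n = Vec (SLetter n) n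

∣_∣ : ∀ {n} → SLetter n → Fin n
∣ x ∣ = proj₁ x

barred : ∀ {n} → SLetter n → Bool
barred x = proj₂ x

-- Signed permutation: each of 1..n appears exactly once (up to bars),
-- i.e. the map of positions to underlying values is injective (hence bijective).
IsSignedPerm : ∀ {n} → SWord n → Set
IsSignedPerm {n} α = ∀ (i j : Fin n) → ∣ lookup α i ∣ ≡ ∣ lookup α j ∣ → i ≡ j

Contains : ∀ {n k} → SWord n → SWord k → Set
Contains {n} {k} α τ =
  Σ[ ι ∈ (Fin k → Fin n) ]
    ((∀ (p q : Fin k) → p <ᶠ q → ι p <ᶠ ι q)
    × (∀ (p q : Fin k) →
         (∣ lookup τ q ∣ <ᶠ ∣ lookup τ p ∣ → ∣ lookup α (ι q) ∣ <ᶠ ∣ lookup α (ι p) ∣)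
       × (∣ lookup α (ι q) ∣ <ᶠ ∣ lookup α (ι p) ∣ → ∣ lookup τ q ∣ <ᶠ ∣ lookup τ p ∣))
    × (∀ (j : Fin k) → barred (lookup α (ι j)) ≡ barred (lookup τ j)))

Avoids : ∀ {n k} → SWord n → SWord k → Set
Avoids α τ = ¬ Contains α τ

Pattern2 : Set
Pattern2 = SWord 2

InB : ∀ {n} → List Pattern2 → SWord n → Set
InB T α = IsSignedPerm α × (∀ τ → τ ∈ T → Avoids α τ)

bIs : ℕ → List Pattern2 → ℕ → Set
bIs n T m = Σ[ xs ∈ List (SWord n) ]
  (Unique xs × (∀ α → (α ∈ xs ⇔ InB T α)) × length xs ≡ m)

open import Data.Fin using (zero; suc)
u1 u2 o1 o2 : SLetter 2
u1 = (zero , false)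
u2 = (suc zero , false)
o1 = (zero , true)
o2 = (suc zero , true)

pat : SLetter 2 → SLetter 2 → Pattern2
pat x y = x ∷ y ∷ []

sumTo : ℕ → (ℕ → ℕ) → ℕ
sumTo zero f = f 0
sumTo (suc m) f = sumTo m f + f (suc m)

sumBelow : ℕ → (ℕ → ℕ) → ℕ
sumBelow zero f = 0
sumBelow (suc m) f = sumBelow m f + f m

{-# OPTIONS --safe #-}
-- All patterns have length 2, so avoiding T is a condition on pairs of positions: no pair of
-- letters may have the type (left bar, right bar, left smaller?) of a pattern of T.  Removing the
-- largest letter maps B_{n+1}(T) bijectively onto the triples (β, p, b) with β ∈ B_n(T) such that
-- a new maximum with bar b may be inserted at position p, and whether it may depends only on the
-- bar word of β.  Hence b_n(T) counts the nodes at depth n of a generating tree on bar words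
-- (descendants T n []), and each of the sixteen formulas comes from evaluating that tree on the
-- few shapes of bar words that actually occur: blocks of barred and of unbarred letters.
module Submission where

open import Defs
open import Data.Nat as ℕ using (ℕ; zero; suc; _≤_; _+_; _*_; _∸_; _^_; _!; z≤n; s≤s)
import Data.Nat.Properties as ℕ
open import Data.Nat.Combinatorics using (_C_; nCk+nC[k+1]≡[n+1]C[k+1]; nC1≡n)
open import Data.Fin as Fin using (Fin; toℕ; fromℕ; inject₁; lower₁; punchIn; punchOut)
import Data.Fin.Properties as Fin
open import Data.Fin.Patterns using (0F; 1F)
open import Data.Bool using (Bool; true; false; not; _∧_; if_then_else_)
import Data.Bool.Properties as Bool
open import Data.Product using (_×_; _,_; proj₁; proj₂; ∃₂; ∃-syntax)
import Data.Product.Properties as Product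
open import Data.Vec as V using (Vec; lookup; insertAt)
import Data.Vec.Properties as V
open import Data.List as L using (List; []; _∷_; _++_; replicate)
open import Data.Bool.ListAction using (all)
open import Data.List.Relation.Unary.All as All using (All; []; _∷_)
open import Data.List.Membership.Propositional using (_∈_)
open import Data.List.Membership.DecPropositional
  (Product.≡-dec Bool._≟_ (Product.≡-dec Bool._≟_ Bool._≟_)) using (_∈?_)
import Data.List.Membership.Propositional.Properties as ∈
open import Data.List.Relation.Unary.Any using (here; there)
open import Data.List.Relation.Unary.Unique.Propositional using (Unique)
import Data.List.Relation.Unary.Unique.Propositional.Properties as Unique
open import Data.List.Relation.Unary.AllPairs using ([]; _∷_)
import Data.List.Properties as L
open import Data.Nat.ListAction using (sum)
import Data.Nat.ListAction.Properties as ℕ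
open import Data.Empty using (⊥-elim)
open import Function using (_∘_; _⇔_; mk⇔; Equivalence; case_of_)
open import Relation.Nullary using (¬_; Dec; yes; no; does; contradiction)
open import Relation.Nullary.Decidable using (dec-true; dec-false; does-⇔; ¬?; True; toWitness)
open import Relation.Binary.PropositionalEquality
open import Data.Nat.Tactic.RingSolver using (solve-∀)
open import Relation.Binary.Definitions using (tri<; tri≈; tri>)

-- Pair types

PairType : Set
PairType = Bool × Bool × Bool

pairType : ∀ {n} → SLetter n → SLetter n → PairType
pairType x y = barred x , barred y , does (∣ x ∣ Fin.<? ∣ y ∣)

first second : Pattern2 → SLetter 2
first τ = lookup τ 0F
second τ = lookup τ 1F

patternType : Pattern2 → PairType
patternType τ = pairType (first τ) (second τ)

-- Pattern2 also contains degenerate words such as 1 1: no signed permutation contains them,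
-- yet their pair type would be forbidden.
Distinct : Pattern2 → Set
Distinct τ = ∣ first τ ∣ ≢ ∣ second τ ∣

distinct? : ∀ τ → Dec (Distinct τ)
distinct? τ = ¬? (∣ first τ ∣ Fin.≟ ∣ second τ ∣)

forbidden : List Pattern2 → PairType → Bool
forbidden T t = does (t ∈? L.map patternType T)

HasPairOfType : ∀ {n} → SWord n → PairType → Set
HasPairOfType α t = ∃₂ λ i j → i Fin.< j × pairType (lookup α i) (lookup α j) ≡ t

AvoidsPairTypes : ∀ {n} → List Pattern2 → SWord n → Set
AvoidsPairTypes T α = ∀ {i j} → i Fin.< j → forbidden T (pairType (lookup α i) (lookup α j)) ≡ false

does-≡⇒⇔ : ∀ {A B : Set} (a? : Dec A) (b? : Dec B) → does a? ≡ does b? → A ⇔ B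
does-≡⇒⇔ (yes a) (yes b) _ = mk⇔ (λ _ → b) (λ _ → a)
does-≡⇒⇔ (no ¬a) (no ¬b) _ = mk⇔ (⊥-elim ∘ ¬a) (⊥-elim ∘ ¬b)

<-flip-⇔ : ∀ {m n} {x y : Fin m} {u v : Fin n} → x ≢ y → u ≢ v →
  x Fin.< y ⇔ u Fin.< v → y Fin.< x ⇔ v Fin.< u
<-flip-⇔ {x = x} {y} {u} {v} x≢y u≢v x<y⇔u<v =
  mk⇔ (flip u≢v (x<y⇔u<v .Equivalence.from)) (flip x≢y (x<y⇔u<v .Equivalence.to))
  where
  flip : ∀ {k l} {a b : Fin k} {c d : Fin l} → c ≢ d → (c Fin.< d → a Fin.< b) → b Fin.< a → d Fin.< c
  flip c≢d c<d⇒a<b b<a with Fin.<-cmp _ _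
  ... | tri< c<d _ _ = contradiction (c<d⇒a<b c<d) (Fin.<-asym b<a)
  ... | tri≈ _ c≡d _ = contradiction c≡d c≢d
  ... | tri> _ _ d<c = d<c

contains⇒hasPairOfType : ∀ {n} {α : SWord n} {τ} → Contains α τ → HasPairOfType α (patternType τ)
contains⇒hasPairOfType {α = α} {τ} (ι , ι-mono , ι-order , ι-bars) =
  ι 0F , ι 1F , ι-mono 0F 1F (s≤s z≤n) ,
  cong₂ _,_ (ι-bars 0F) (cong₂ _,_ (ι-bars 1F) (does-⇔ ascending (_ Fin.<? _) (_ Fin.<? _)))
  where
  ascending : ∣ lookup α (ι 0F) ∣ Fin.< ∣ lookup α (ι 1F) ∣ ⇔ ∣ first τ ∣ Fin.< ∣ second τ ∣
  ascending = mk⇔ (proj₂ (ι-order 1F 0F)) (proj₁ (ι-order 1F 0F))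

hasPairOfType⇒contains : ∀ {n} {α : SWord n} {τ} → IsSignedPerm α → Distinct τ →
  HasPairOfType α (patternType τ) → Contains α τ
hasPairOfType⇒contains {α = α} {τ} perm τ-distinct (i , j , i<j , same) = ι , ι-mono , ι-order , ι-bars
  where
  ι : Fin 2 → Fin _
  ι = lookup (i V.∷ j V.∷ V.[])
  ascending : ∣ lookup α i ∣ Fin.< ∣ lookup α j ∣ ⇔ ∣ first τ ∣ Fin.< ∣ second τ ∣
  ascending = does-≡⇒⇔ (_ Fin.<? _) (_ Fin.<? _) (cong (proj₂ ∘ proj₂) same)
  descending : ∣ lookup α j ∣ Fin.< ∣ lookup α i ∣ ⇔ ∣ second τ ∣ Fin.< ∣ first τ ∣
  descending = <-flip-⇔ (λ e → Fin.<-irrefl (perm i j e) i<j) τ-distinct ascending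
  ι-mono : ∀ p q → p Fin.< q → ι p Fin.< ι q
  ι-mono 0F 1F _ = i<j
  ι-mono 1F 1F (s≤s ())
  irrefl : ∀ {k} {x : Fin k} {A : Set} → x Fin.< x → A
  irrefl x<x = contradiction x<x (Fin.<-irrefl refl)
  ι-order : ∀ p q →
      (∣ lookup τ q ∣ Fin.< ∣ lookup τ p ∣ → ∣ lookup α (ι q) ∣ Fin.< ∣ lookup α (ι p) ∣)
    × (∣ lookup α (ι q) ∣ Fin.< ∣ lookup α (ι p) ∣ → ∣ lookup τ q ∣ Fin.< ∣ lookup τ p ∣)
  ι-order 0F 0F = irrefl , irrefl
  ι-order 0F 1F = descending .Equivalence.from , descending .Equivalence.to
  ι-order 1F 0F = ascending .Equivalence.from , ascending .Equivalence.to
  ι-order 1F 1F = irrefl , irrefl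
  ι-bars : ∀ p → barred (lookup α (ι p)) ≡ barred (lookup τ p)
  ι-bars 0F = cong proj₁ same
  ι-bars 1F = cong (proj₁ ∘ proj₂) same

avoids⇔avoidsPairTypes : ∀ {n} {T} {α : SWord n} → All Distinct T → IsSignedPerm α →
  (∀ τ → τ ∈ T → Avoids α τ) ⇔ AvoidsPairTypes T α
avoids⇔avoidsPairTypes {T = T} {α} distinct perm = mk⇔ to from
  where
  to : (∀ τ → τ ∈ T → Avoids α τ) → AvoidsPairTypes T α
  to avoids {i} {j} i<j = dec-false (_ ∈? _) λ t∈T → case ∈.∈-map⁻ patternType t∈T of λ where
    (τ , τ∈T , same) →
      avoids τ τ∈T (hasPairOfType⇒contains {α = α} {τ} perm (All.lookup distinct τ∈T) (i , j , i<j , same))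
  from : AvoidsPairTypes T α → ∀ τ → τ ∈ T → Avoids α τ
  from avoidsPairTypes τ τ∈T contains with contains⇒hasPairOfType {α = α} {τ} contains
  ... | i , j , i<j , same = contradiction (trans (sym isForbidden) isAllowed) λ ()
    where
    isForbidden : forbidden T (patternType τ) ≡ true
    isForbidden = dec-true (_ ∈? _) (∈.∈-map⁺ patternType τ∈T)
    isAllowed : forbidden T (patternType τ) ≡ false
    isAllowed = subst (λ t → forbidden T t ≡ false) same (avoidsPairTypes i<j)

-- Inserting and removing the maximum

raise : ∀ {n} → SLetter n → SLetter (suc n)
raise (v , s) = inject₁ v , s

raise-injective : ∀ {n} {x y : SLetter n} → raise x ≡ raise y → x ≡ y
raise-injective e = cong₂ _,_ (Fin.inject₁-injective (cong proj₁ e)) (cong proj₂ e)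

map-raise-injective : ∀ {n k} {β β′ : Vec (SLetter n) k} → V.map raise β ≡ V.map raise β′ → β ≡ β′
map-raise-injective {β = V.[]} {V.[]} _ = refl
map-raise-injective {β = _ V.∷ _} {_ V.∷ _} e =
  cong₂ V._∷_ (raise-injective (V.∷-injectiveˡ e)) (map-raise-injective (V.∷-injectiveʳ e))

insertMax : ∀ {n} → SWord n → Fin (suc n) → Bool → SWord (suc n)
insertMax β p b = insertAt (V.map raise β) p (fromℕ _ , b)

lookup-insertMax-at : ∀ {n} (β : SWord n) p b → lookup (insertMax β p b) p ≡ (fromℕ n , b)
lookup-insertMax-at β p b = V.insertAt-lookup (V.map raise β) p _

lookup-insertMax-punchIn : ∀ {n} (β : SWord n) p b i →
  lookup (insertMax β p b) (punchIn p i) ≡ raise (lookup β i)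
lookup-insertMax-punchIn β p b i = trans (V.insertAt-punchIn (V.map raise β) p _ i) (V.lookup-map i raise β)

data PunchView {n} (p : Fin (suc n)) : Fin (suc n) → Set where
  at      : PunchView p p
  punched : (i : Fin n) → PunchView p (punchIn p i)

punchView : ∀ {n} (p i : Fin (suc n)) → PunchView p i
punchView p i with i Fin.≟ p
... | yes refl = at
... | no i≢p = subst (PunchView p) (Fin.punchIn-punchOut (i≢p ∘ sym)) (punched (punchOut (i≢p ∘ sym)))

module _ {n} (β : SWord n) (p : Fin (suc n)) (b : Bool) where

  private
    value : Fin (suc n) → Fin (suc n)
    value k = ∣ lookup (insertMax β p b) k ∣

    value-at : value p ≡ fromℕ n
    value-at = cong proj₁ (lookup-insertMax-at β p b)

    value-punchIn : ∀ k → value (punchIn p k) ≡ inject₁ ∣ lookup β k ∣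
    value-punchIn k = cong proj₁ (lookup-insertMax-punchIn β p b k)

  insertMax-isSignedPerm : IsSignedPerm β → IsSignedPerm (insertMax β p b)
  insertMax-isSignedPerm perm i j = go (punchView p i) (punchView p j)
    where
    go : ∀ {i j} → PunchView p i → PunchView p j → value i ≡ value j → i ≡ j
    go at at _ = refl
    go at (punched k) e = contradiction (trans (sym value-at) (trans e (value-punchIn k))) Fin.fromℕ≢inject₁
    go (punched k) at e = contradiction (trans (sym value-at) (trans (sym e) (value-punchIn k))) Fin.fromℕ≢inject₁
    go (punched k) (punched l) e = cong (punchIn p) (perm k l (Fin.inject₁-injective
      (trans (sym (value-punchIn k)) (trans e (value-punchIn l)))))

  insertMax-isSignedPerm⁻ : IsSignedPerm (insertMax β p b) → IsSignedPerm β
  insertMax-isSignedPerm⁻ perm i j e = Fin.punchIn-injective p i j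
    (perm (punchIn p i) (punchIn p j) (trans (value-punchIn i) (trans (cong inject₁ e) (sym (value-punchIn j)))))

  insertMax-position : ∀ {β′ p′ b′} → insertMax β p b ≡ insertMax β′ p′ b′ → p ≡ p′
  insertMax-position {β′} {p′} {b′} e = go (punchView p′ p)
    where
    go : PunchView p′ p → p ≡ p′
    go at = refl
    go (punched k) = contradiction
      (trans (sym value-at) (trans (cong (λ α → ∣ lookup α (punchIn p′ k) ∣) e)
                                   (cong proj₁ (lookup-insertMax-punchIn β′ p′ b′ k))))
      Fin.fromℕ≢inject₁

insertMax-injective : ∀ {n} {β β′ : SWord n} {p p′ b b′} →
  insertMax β p b ≡ insertMax β′ p′ b′ → (β , b , p) ≡ (β′ , b′ , p′)
insertMax-injective {β = β} {β′} {p} {p′} {b} {b′} e with insertMax-position β p b e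
... | refl = cong₂ _,_ (map-raise-injective raised) (cong₂ _,_ (cong proj₂ barOfMax) refl)
  where
  raised : V.map raise β ≡ V.map raise β′
  raised = trans (sym (V.removeAt-insertAt _ p _))
                 (trans (cong (λ α → V.removeAt α p) e) (V.removeAt-insertAt _ p _))
  barOfMax : (fromℕ _ , b) ≡ (fromℕ _ , b′)
  barOfMax = trans (sym (lookup-insertMax-at β p b))
                   (trans (cong (λ α → lookup α p) e) (lookup-insertMax-at β′ p b′))

lookup-removeAt : ∀ {A : Set} {n} (xs : Vec A (suc n)) i k →
  lookup (V.removeAt xs i) k ≡ lookup xs (punchIn i k)
lookup-removeAt xs i k = trans (cong (lookup (V.removeAt xs i)) (sym (Fin.punchOut-punchIn i)))
  (V.removeAt-punchOut xs (Fin.punchInᵢ≢i i k ∘ sym))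

lowerAll : ∀ {n k} (γ : Vec (SLetter (suc n)) k) → (∀ i → ∣ lookup γ i ∣ ≢ fromℕ n) →
  ∃[ β ] γ ≡ V.map raise β
lowerAll V.[] _ = V.[] , refl
lowerAll ((v , s) V.∷ γ) notMax =
  let β , γ≡ = lowerAll γ (notMax ∘ Fin.suc)
  in (lower₁ v n≢v , s) V.∷ β , cong₂ V._∷_ (cong (_, s) (sym (Fin.inject₁-lower₁ v n≢v))) γ≡
  where
  n≢v : _ ≢ toℕ v
  n≢v e = notMax Fin.zero (Fin.toℕ-injective (trans (sym e) (sym (Fin.toℕ-fromℕ _))))

maxPosition : ∀ {n} (α : SWord (suc n)) → IsSignedPerm α → ∃[ p ] ∣ lookup α p ∣ ≡ fromℕ n
maxPosition {n} α perm with Fin.any? (λ k → ∣ lookup α k ∣ Fin.≟ fromℕ n)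
... | yes found = found
... | no none = ⊥-elim (noCollision (Fin.pigeonhole (ℕ.n<1+n n) lowered))
  where
  n≢value : ∀ k → n ≢ toℕ ∣ lookup α k ∣
  n≢value k e = none (k , Fin.toℕ-injective (trans (sym e) (sym (Fin.toℕ-fromℕ n))))
  lowered : Fin (suc n) → Fin n
  lowered k = lower₁ ∣ lookup α k ∣ (n≢value k)
  noCollision : ¬ ∃₂ λ i j → i Fin.< j × lowered i ≡ lowered j
  noCollision (i , j , i<j , e) = Fin.<-irrefl (perm i j (Fin.lower₁-injective e)) i<j

removeMax : ∀ {n} (α : SWord (suc n)) → IsSignedPerm α → ∃[ β ] ∃[ p ] ∃[ b ] α ≡ insertMax β p b
removeMax α perm =
  let p , p-max = maxPosition α perm
      β , rest≡ = lowerAll (V.removeAt α p) λ k e →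
        Fin.punchInᵢ≢i p k (perm _ _ (trans (cong proj₁ (sym (lookup-removeAt α p k))) (trans e (sym p-max))))
  in β , p , barred (lookup α p) ,
     trans (sym (V.insertAt-removeAt α p))
           (cong₂ (λ γ x → insertAt γ p x) rest≡ (cong (_, barred (lookup α p)) p-max))

pairType-raise : ∀ {n} (x y : SLetter n) → pairType (raise x) (raise y) ≡ pairType x y
pairType-raise (u , s) (v , t) = cong (λ o → s , t , o) (does-⇔ (mk⇔ to from) (_ Fin.<? _) (_ Fin.<? _))
  where
  to : inject₁ u Fin.< inject₁ v → u Fin.< v
  to = subst₂ ℕ._<_ (Fin.toℕ-inject₁ u) (Fin.toℕ-inject₁ v)
  from : u Fin.< v → inject₁ u Fin.< inject₁ v
  from = subst₂ ℕ._<_ (sym (Fin.toℕ-inject₁ u)) (sym (Fin.toℕ-inject₁ v))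

inject₁<fromℕ : ∀ {n} (i : Fin n) → inject₁ i Fin.< fromℕ n
inject₁<fromℕ {n} i = subst₂ ℕ._<_ (sym (Fin.toℕ-inject₁ i)) (sym (Fin.toℕ-fromℕ n)) (Fin.toℕ<n i)

pairType-raise-max : ∀ {n} (x : SLetter n) b → pairType (raise x) (fromℕ n , b) ≡ (barred x , b , true)
pairType-raise-max x b = cong (λ o → barred x , b , o) (dec-true (_ Fin.<? _) (inject₁<fromℕ ∣ x ∣))

pairType-max-raise : ∀ {n} (x : SLetter n) b → pairType (fromℕ n , b) (raise x) ≡ (b , barred x , false)
pairType-max-raise x b =
  cong (λ o → b , barred x , o) (dec-false (_ Fin.<? _) (Fin.<-asym (inject₁<fromℕ ∣ x ∣)))

punchIn-mono-< : ∀ {n} (p : Fin (suc n)) {i j : Fin n} → i Fin.< j → punchIn p i Fin.< punchIn p j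
punchIn-mono-< Fin.zero i<j = s≤s i<j
punchIn-mono-< (Fin.suc p) {Fin.zero} {Fin.suc j} _ = s≤s z≤n
punchIn-mono-< (Fin.suc p) {Fin.suc i} {Fin.suc j} (s≤s i<j) = s≤s (punchIn-mono-< p i<j)

punchIn-cancel-< : ∀ {n} (p : Fin (suc n)) {i j : Fin n} → punchIn p i Fin.< punchIn p j → i Fin.< j
punchIn-cancel-< Fin.zero (s≤s i<j) = i<j
punchIn-cancel-< (Fin.suc p) {Fin.zero} {Fin.suc j} _ = s≤s z≤n
punchIn-cancel-< (Fin.suc p) {Fin.suc i} {Fin.suc j} (s≤s i<j) = s≤s (punchIn-cancel-< p i<j)

punchIn<⇒< : ∀ {n} (p : Fin (suc n)) {i : Fin n} → punchIn p i Fin.< p → i Fin.< p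
punchIn<⇒< (Fin.suc p) {Fin.zero} _ = s≤s z≤n
punchIn<⇒< (Fin.suc p) {Fin.suc i} (s≤s i<p) = s≤s (punchIn<⇒< p i<p)

<punchIn⇒≤ : ∀ {n} (p : Fin (suc n)) {i : Fin n} → p Fin.< punchIn p i → p Fin.≤ i
<punchIn⇒≤ Fin.zero _ = z≤n
<punchIn⇒≤ (Fin.suc p) {Fin.suc i} (s≤s p<i) = s≤s (<punchIn⇒≤ p p<i)

<⇒punchIn< : ∀ {n} (p : Fin (suc n)) {i : Fin n} → i Fin.< p → punchIn p i Fin.< p
<⇒punchIn< (Fin.suc p) {Fin.zero} _ = s≤s z≤n
<⇒punchIn< (Fin.suc p) {Fin.suc i} (s≤s i<p) = s≤s (<⇒punchIn< p i<p)

≤⇒<punchIn : ∀ {n} (p : Fin (suc n)) {i : Fin n} → p Fin.≤ i → p Fin.< punchIn p i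
≤⇒<punchIn Fin.zero _ = s≤s z≤n
≤⇒<punchIn (Fin.suc p) {Fin.suc i} (s≤s p≤i) = s≤s (≤⇒<punchIn p p≤i)

∧≡true : ∀ {x y} → x ∧ y ≡ true → x ≡ true × y ≡ true
∧≡true {true} y≡true = refl , y≡true

leftOk rightOk : List Pattern2 → Bool → Bool → Bool
leftOk T b s = not (forbidden T (s , b , true))
rightOk T b s = not (forbidden T (b , s , false))

validAt : (Bool → Bool) → (Bool → Bool) → ∀ {k} → Vec Bool k → Fin (suc k) → Bool
validAt L R v Fin.zero = all R (V.toList v)
validAt L R (x V.∷ v) (Fin.suc p) = L x ∧ validAt L R v p

module _ (L R : Bool → Bool) where

  validAt-intro : ∀ {k} (v : Vec Bool k) p → (∀ i → i Fin.< p → L (lookup v i) ≡ true) →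
    (∀ i → p Fin.≤ i → R (lookup v i) ≡ true) → validAt L R v p ≡ true
  validAt-intro V.[] Fin.zero _ _ = refl
  validAt-intro (x V.∷ v) Fin.zero _ right rewrite right Fin.zero z≤n =
    validAt-intro v Fin.zero (λ _ ()) (λ i _ → right (Fin.suc i) z≤n)
  validAt-intro (x V.∷ v) (Fin.suc p) left right rewrite left Fin.zero (s≤s z≤n) =
    validAt-intro v p (λ i i<p → left (Fin.suc i) (s≤s i<p)) (λ i p≤i → right (Fin.suc i) (s≤s p≤i))

  validAt-left : ∀ {k} (v : Vec Bool k) p → validAt L R v p ≡ true → ∀ i → i Fin.< p → L (lookup v i) ≡ true
  validAt-left (x V.∷ v) (Fin.suc p) valid Fin.zero _ = proj₁ (∧≡true valid)
  validAt-left (x V.∷ v) (Fin.suc p) valid (Fin.suc i) (s≤s i<p) =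
    validAt-left v p (proj₂ (∧≡true valid)) i i<p

  validAt-right : ∀ {k} (v : Vec Bool k) p → validAt L R v p ≡ true → ∀ i → p Fin.≤ i → R (lookup v i) ≡ true
  validAt-right (x V.∷ v) Fin.zero valid Fin.zero _ = proj₁ (∧≡true valid)
  validAt-right (x V.∷ v) Fin.zero valid (Fin.suc i) _ = validAt-right v Fin.zero (proj₂ (∧≡true valid)) i z≤n
  validAt-right (x V.∷ v) (Fin.suc p) valid (Fin.suc i) (s≤s p≤i) =
    validAt-right v p (proj₂ (∧≡true valid)) i p≤i

bars : ∀ {n k} → Vec (SLetter n) k → Vec Bool k
bars = V.map barred

module _ (T : List Pattern2) {n} (β : SWord n) (p : Fin (suc n)) (b : Bool) where

  private
    α : SWord (suc n)
    α = insertMax β p b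

    Allowed : PairType → Set
    Allowed t = forbidden T t ≡ false

    type-punched : ∀ i j →
      pairType (lookup α (punchIn p i)) (lookup α (punchIn p j)) ≡ pairType (lookup β i) (lookup β j)
    type-punched i j = trans (cong₂ pairType (lookup-insertMax-punchIn β p b i) (lookup-insertMax-punchIn β p b j))
      (pairType-raise (lookup β i) (lookup β j))

    type-left : ∀ i → pairType (lookup α (punchIn p i)) (lookup α p) ≡ (lookup (bars β) i , b , true)
    type-left i = trans (cong₂ pairType (lookup-insertMax-punchIn β p b i) (lookup-insertMax-at β p b))
      (trans (pairType-raise-max (lookup β i) b) (cong (λ s → s , b , true) (sym (V.lookup-map i barred β))))

    type-right : ∀ i → pairType (lookup α p) (lookup α (punchIn p i)) ≡ (b , lookup (bars β) i , false)
    type-right i = trans (cong₂ pairType (lookup-insertMax-at β p b) (lookup-insertMax-punchIn β p b i))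
      (trans (pairType-max-raise (lookup β i) b) (cong (λ s → b , s , false) (sym (V.lookup-map i barred β))))

  insertMax-avoidsPairTypes⁻ : AvoidsPairTypes T α →
    AvoidsPairTypes T β × validAt (leftOk T b) (rightOk T b) (bars β) p ≡ true
  insertMax-avoidsPairTypes⁻ avoids = avoidsβ , validAt-intro _ _ (bars β) p left right
    where
    avoidsβ : AvoidsPairTypes T β
    avoidsβ {i} {j} i<j = subst Allowed (type-punched i j) (avoids (punchIn-mono-< p i<j))
    left : ∀ i → i Fin.< p → leftOk T b (lookup (bars β) i) ≡ true
    left i i<p = cong not (subst Allowed (type-left i) (avoids (<⇒punchIn< p i<p)))
    right : ∀ i → p Fin.≤ i → rightOk T b (lookup (bars β) i) ≡ true
    right i p≤i = cong not (subst Allowed (type-right i) (avoids (≤⇒<punchIn p p≤i)))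

  insertMax-avoidsPairTypes : AvoidsPairTypes T β → validAt (leftOk T b) (rightOk T b) (bars β) p ≡ true →
    AvoidsPairTypes T α
  insertMax-avoidsPairTypes avoidsβ valid {i} {j} = go (punchView p i) (punchView p j)
    where
    go : ∀ {i j} → PunchView p i → PunchView p j → i Fin.< j → Allowed (pairType (lookup α i) (lookup α j))
    go at at p<p = contradiction p<p (Fin.<-irrefl refl)
    go at (punched k) p<k = subst Allowed (sym (type-right k))
      (Bool.not-injective (validAt-right _ _ (bars β) p valid k (<punchIn⇒≤ p p<k)))
    go (punched k) at k<p = subst Allowed (sym (type-left k))
      (Bool.not-injective (validAt-left _ _ (bars β) p valid k (punchIn<⇒< p k<p)))
    go (punched k) (punched l) k<l = subst Allowed (sym (type-punched k l)) (avoidsβ (punchIn-cancel-< p k<l))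

-- The generating tree

sumValid : (Bool → Bool) → (Bool → Bool) → Bool → (List Bool → ℕ) → List Bool → ℕ
sumValid L R b f [] = f (b ∷ [])
sumValid L R b f (x ∷ xs) =
  (if all R (x ∷ xs) then f (b ∷ x ∷ xs) else 0) + (if L x then sumValid L R b (λ w → f (x ∷ w)) xs else 0)

sum-tabulate-0 : ∀ k → sum (L.tabulate {n = k} (λ _ → 0)) ≡ 0
sum-tabulate-0 zero = refl
sum-tabulate-0 (suc k) = sum-tabulate-0 k

sumValid-positions : ∀ L R b (g : List Bool → ℕ) {k} (v : Vec Bool k) →
  sum (L.tabulate (λ p → if validAt L R v p then g (V.toList (insertAt v p b)) else 0))
    ≡ sumValid L R b g (V.toList v)
sumValid-positions L R b g V.[] = ℕ.+-identityʳ _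
sumValid-positions L R b g {suc k} (x V.∷ v) = cong (_ +_) (later (L x))
  where
  later : ∀ c → sum (L.tabulate (λ p → if c ∧ validAt L R v p then g (x ∷ V.toList (insertAt v p b)) else 0))
                ≡ (if c then sumValid L R b (λ w → g (x ∷ w)) (V.toList v) else 0)
  later true = sumValid-positions L R b (λ w → g (x ∷ w)) v
  later false = sum-tabulate-0 (suc k)

insertions : List Pattern2 → Bool → (List Bool → ℕ) → List Bool → ℕ
insertions T b = sumValid (leftOk T b) (rightOk T b) b

descendants : List Pattern2 → ℕ → List Bool → ℕ
descendants T zero w = 1
descendants T (suc r) w = insertions T false (descendants T r) w + insertions T true (descendants T r) w

barWord : ∀ {n} → SWord n → List Bool
barWord α = V.toList (bars α)

barWord-insertMax : ∀ {n} (β : SWord n) p b → barWord (insertMax β p b) ≡ V.toList (insertAt (bars β) p b)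
barWord-insertMax β p b = cong V.toList
  (trans (V.map-insertAt barred _ (V.map raise β) p)
         (cong (λ v → insertAt v p b) (sym (V.map-∘ barred raise β))))

sum-cartesianProduct : ∀ {A B : Set} (h : A × B → ℕ) xs ys →
  sum (L.map h (L.cartesianProduct xs ys)) ≡ sum (L.map (λ x → sum (L.map (λ y → h (x , y)) ys)) xs)
sum-cartesianProduct h [] ys = refl
sum-cartesianProduct h (x ∷ xs) ys = begin
  sum (L.map h (L.map (x ,_) ys ++ L.cartesianProduct xs ys))
    ≡⟨ cong sum (L.map-++ h (L.map (x ,_) ys) _) ⟩
  sum (L.map h (L.map (x ,_) ys) ++ L.map h (L.cartesianProduct xs ys))
    ≡⟨ ℕ.sum-++ (L.map h (L.map (x ,_) ys)) _ ⟩
  sum (L.map h (L.map (x ,_) ys)) + sum (L.map h (L.cartesianProduct xs ys))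
    ≡⟨ cong₂ _+_ (cong sum (sym (L.map-∘ ys))) (sum-cartesianProduct h xs ys) ⟩
  sum (L.map (λ y → h (x , y)) ys) + sum (L.map (λ x → sum (L.map (λ y → h (x , y)) ys)) xs) ∎
  where open ≡-Reasoning

sum-filter : ∀ {A : Set} (c : A → Bool) (h : A → ℕ) xs →
  sum (L.map h (L.filter (λ x → c x Bool.≟ true) xs)) ≡ sum (L.map (λ x → if c x then h x else 0) xs)
sum-filter c h [] = refl
sum-filter c h (x ∷ xs) with c x
... | true = cong (h x +_) (sum-filter c h xs)
... | false = sum-filter c h xs

sum-map-cong : ∀ {A : Set} {f g : A → ℕ} xs → (∀ x → f x ≡ g x) → sum (L.map f xs) ≡ sum (L.map g xs)
sum-map-cong xs f≗g = cong sum (L.map-cong f≗g xs)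

length≡sum-map-1 : ∀ {A : Set} (xs : List A) → L.length xs ≡ sum (L.map (λ _ → 1) xs)
length≡sum-map-1 [] = refl
length≡sum-map-1 (x ∷ xs) = cong suc (length≡sum-map-1 xs)

record Enumeration (T : List Pattern2) (n : ℕ) : Set where
  field
    words    : List (SWord n)
    unique   : Unique words
    complete : ∀ α → α ∈ words ⇔ (IsSignedPerm α × AvoidsPairTypes T α)
    weights  : ∀ r → sum (L.map (descendants T r ∘ barWord) words) ≡ descendants T (n + r) []

module Extend {T : List Pattern2} {n : ℕ} (E : Enumeration T n) where

  open Enumeration E

  Candidate : Set
  Candidate = SWord n × Bool × Fin (suc n)

  candidates : List Candidate
  candidates = L.cartesianProduct words (L.cartesianProduct (false ∷ true ∷ []) (L.allFin (suc n)))

  valid : Candidate → Bool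
  valid (β , b , p) = validAt (leftOk T b) (rightOk T b) (bars β) p

  insert : Candidate → SWord (suc n)
  insert (β , b , p) = insertMax β p b

  valid? : ∀ c → Dec (valid c ≡ true)
  valid? c = valid c Bool.≟ true

  words′ : List (SWord (suc n))
  words′ = L.map insert (L.filter valid? candidates)

  unique′ : Unique words′
  unique′ = Unique.map⁺ insertMax-injective (Unique.filter⁺ valid?
    (Unique.cartesianProduct⁺ unique
      (Unique.cartesianProduct⁺ (((λ ()) ∷ []) ∷ [] ∷ []) (Unique.allFin⁺ (suc n)))))

  complete′ : ∀ α → α ∈ words′ ⇔ (IsSignedPerm α × AvoidsPairTypes T α)
  complete′ α = mk⇔ to from
    where
    to : α ∈ words′ → IsSignedPerm α × AvoidsPairTypes T α
    to α∈ with ∈.∈-map⁻ insert α∈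
    ... | (β , b , p) , c∈ , refl with ∈.∈-filter⁻ valid? c∈
    ... | c∈candidates , isValid
      with complete β .Equivalence.to (proj₁ (∈.∈-cartesianProduct⁻ words _ c∈candidates))
    ... | permβ , avoidsβ = insertMax-isSignedPerm β p b permβ , insertMax-avoidsPairTypes T β p b avoidsβ isValid
    from : IsSignedPerm α × AvoidsPairTypes T α → α ∈ words′
    from (perm , avoids) with removeMax α perm
    ... | β , p , b , refl with insertMax-avoidsPairTypes⁻ T β p b avoids
    ... | avoidsβ , isValid = ∈.∈-map⁺ insert (∈.∈-filter⁺ valid?
      (∈.∈-cartesianProduct⁺ (complete β .Equivalence.from (insertMax-isSignedPerm⁻ β p b perm , avoidsβ))
        (∈.∈-cartesianProduct⁺ (barIn b) (∈.∈-allFin p))) isValid)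
      where
      barIn : ∀ b → b ∈ false ∷ true ∷ []
      barIn false = here refl
      barIn true = there (here refl)

  children : ∀ r β b →
    sum (L.map (λ p → if valid (β , b , p) then descendants T r (barWord (insertMax β p b)) else 0) (L.allFin (suc n)))
      ≡ insertions T b (descendants T r) (barWord β)
  children r β b = begin
    sum (L.map (λ p → if valid (β , b , p) then descendants T r (barWord (insertMax β p b)) else 0) (L.allFin (suc n)))
      ≡⟨ sum-map-cong (L.allFin (suc n)) (λ p → cong (λ w → if valid (β , b , p) then descendants T r w else 0)
                                                      (barWord-insertMax β p b)) ⟩
    sum (L.map child (L.allFin (suc n)))
      ≡⟨ cong sum (L.map-tabulate (λ p → p) child) ⟩
    sum (L.tabulate child)
      ≡⟨ sumValid-positions (leftOk T b) (rightOk T b) b (descendants T r) (bars β) ⟩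
    insertions T b (descendants T r) (barWord β) ∎
    where
    open ≡-Reasoning
    child : Fin (suc n) → ℕ
    child p = if valid (β , b , p) then descendants T r (V.toList (insertAt (bars β) p b)) else 0

  weights′ : ∀ r → sum (L.map (descendants T r ∘ barWord) words′) ≡ descendants T (suc n + r) []
  weights′ r = begin
    sum (L.map (descendants T r ∘ barWord) words′)
      ≡⟨ cong sum (sym (L.map-∘ (L.filter valid? candidates))) ⟩
    sum (L.map (weight ∘ insert) (L.filter valid? candidates))
      ≡⟨ sum-filter valid (weight ∘ insert) candidates ⟩
    sum (L.map (λ c → if valid c then weight (insert c) else 0) candidates)
      ≡⟨ sum-cartesianProduct _ words _ ⟩
    sum (L.map (λ β → sum (L.map (λ bp → if valid (β , bp) then weight (insert (β , bp)) else 0)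
                                  (L.cartesianProduct (false ∷ true ∷ []) (L.allFin (suc n))))) words)
      ≡⟨ sum-map-cong words (λ β → trans (sum-cartesianProduct _ (false ∷ true ∷ []) (L.allFin (suc n)))
                                          (cong₂ _+_ (children r β false) (trans (ℕ.+-identityʳ _) (children r β true)))) ⟩
    sum (L.map (descendants T (suc r) ∘ barWord) words)
      ≡⟨ weights (suc r) ⟩
    descendants T (n + suc r) []
      ≡⟨ cong (λ k → descendants T k []) (ℕ.+-suc n r) ⟩
    descendants T (suc n + r) [] ∎
    where
    open ≡-Reasoning
    weight : SWord (suc n) → ℕ
    weight = descendants T r ∘ barWord

  enumeration : Enumeration T (suc n)
  enumeration = record { words = words′ ; unique = unique′ ; complete = complete′ ; weights = weights′ }

enumerate : ∀ T n → Enumeration T n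
enumerate T zero = record
  { words = V.[] ∷ []
  ; unique = [] ∷ []
  ; complete = λ { V.[] → mk⇔ (λ _ → (λ ()) , λ { {()} }) (λ _ → here refl) }
  ; weights = λ _ → ℕ.+-identityʳ _
  }
enumerate T (suc n) = Extend.enumeration (enumerate T n)

bIs-descendants : ∀ {T} n → All Distinct T → bIs n T (descendants T n [])
bIs-descendants {T} n distinct = words , unique , inB , length-words
  where
  open Enumeration (enumerate T n)
  inB : ∀ α → α ∈ words ⇔ InB T α
  inB α = mk⇔ (λ α∈ → let perm , avoids = complete α .Equivalence.to α∈ in
                       perm , avoids⇔avoidsPairTypes {α = α} distinct perm .Equivalence.from avoids)
              (λ (perm , avoids) →
                 complete α .Equivalence.from (perm , avoids⇔avoidsPairTypes {α = α} distinct perm .Equivalence.to avoids))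
  length-words : L.length words ≡ descendants T n []
  length-words = trans (length≡sum-map-1 words)
                       (trans (weights 0) (cong (λ k → descendants T k []) (ℕ.+-identityʳ n)))

bIs-count : ∀ {n m} T {distinct : True (All.all? distinct? T)} → descendants T n [] ≡ m → bIs n T m
bIs-count {n} T {distinct} count = subst (bIs n T) count (bIs-descendants n (toWitness distinct))

-- Sums, rising factorials and iterated sums

double : ∀ x → x + x ≡ 2 * x
double x = cong (x +_) (sym (ℕ.+-identityʳ x))

sumTo-shift : ∀ k g → sumTo (suc k) g ≡ g 0 + sumTo k (g ∘ suc)
sumTo-shift zero g = refl
sumTo-shift (suc k) g = trans (cong (_+ g (suc (suc k))) (sumTo-shift k g)) (ℕ.+-assoc (g 0) _ _)

sumTo-cong : ∀ k {g h} → (∀ i → g i ≡ h i) → sumTo k g ≡ sumTo k h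
sumTo-cong zero g≗h = g≗h 0
sumTo-cong (suc k) g≗h = cong₂ _+_ (sumTo-cong k g≗h) (g≗h (suc k))

sumTo-const : ∀ k v → sumTo k (λ _ → v) ≡ suc k * v
sumTo-const zero v = sym (ℕ.+-identityʳ v)
sumTo-const (suc k) v = trans (cong (_+ v) (sumTo-const k v)) (ℕ.+-comm (suc k * v) v)

sumBelow-shift : ∀ r g → sumBelow (suc r) g ≡ g 0 + sumBelow r (g ∘ suc)
sumBelow-shift zero g = sym (ℕ.+-identityʳ (g 0))
sumBelow-shift (suc r) g = trans (cong (_+ g (suc r)) (sumBelow-shift r g)) (ℕ.+-assoc (g 0) _ _)

sumBelow-* : ∀ r c g → sumBelow r (λ i → c * g i) ≡ c * sumBelow r g
sumBelow-* zero c g = sym (ℕ.*-zeroʳ c)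
sumBelow-* (suc r) c g = trans (cong (_+ c * g r) (sumBelow-* r c g)) (sym (ℕ.*-distribˡ-+ c (sumBelow r g) (g r)))

sumBelow-cong : ∀ r {g h} → (∀ i → g i ≡ h i) → sumBelow r g ≡ sumBelow r h
sumBelow-cong zero _ = refl
sumBelow-cong (suc r) g≗h = cong₂ _+_ (sumBelow-cong r g≗h) (g≗h r)

rising : ℕ → ℕ → ℕ
rising k zero = 1
rising k (suc r) = suc k * rising (suc k) r

rising-*-! : ∀ k r → rising k r * k ! ≡ (k + r) !
rising-*-! k zero = trans (ℕ.*-identityˡ (k !)) (cong _! (sym (ℕ.+-identityʳ k)))
rising-*-! k (suc r) = begin
  suc k * rising (suc k) r * k !    ≡⟨ rearrange (suc k) (rising (suc k) r) (k !) ⟩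
  rising (suc k) r * (suc k * k !)  ≡⟨ rising-*-! (suc k) r ⟩
  (suc k + r) !                     ≡⟨ cong _! (sym (ℕ.+-suc k r)) ⟩
  (k + suc r) !                     ∎
  where
  open ≡-Reasoning
  rearrange : ∀ a b c → a * b * c ≡ b * (a * c)
  rearrange = solve-∀

rising-0 : ∀ r → rising 0 r ≡ r !
rising-0 r = trans (sym (ℕ.*-identityʳ (rising 0 r))) (rising-*-! 0 r)

rising-1 : ∀ r → rising 1 r ≡ suc r !
rising-1 r = trans (sym (ℕ.*-identityʳ (rising 1 r))) (rising-*-! 1 r)

sumTo-rising-suc : ∀ r k → sumTo (suc r) (rising k) ≡ 1 + suc k * sumTo r (rising (suc k))
sumTo-rising-suc zero k = refl
sumTo-rising-suc (suc r) k = begin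
  sumTo (suc r) (rising k) + rising k (suc (suc r))
    ≡⟨ cong (_+ rising k (suc (suc r))) (sumTo-rising-suc r k) ⟩
  1 + suc k * sumTo r (rising (suc k)) + suc k * rising (suc k) (suc r)
    ≡⟨ rearrange (suc k) (sumTo r (rising (suc k))) (rising (suc k) (suc r)) ⟩
  1 + suc k * sumTo (suc r) (rising (suc k)) ∎
  where
  open ≡-Reasoning
  rearrange : ∀ K S a → 1 + K * S + K * a ≡ 1 + K * (S + a)
  rearrange = solve-∀

C2-suc : ∀ r → (suc r + 1) C 2 ≡ (r + 1) C 2 + suc r
C2-suc r = begin
  (suc r + 1) C 2              ≡⟨ sym (nCk+nC[k+1]≡[n+1]C[k+1] (r + 1) 1) ⟩
  (r + 1) C 1 + (r + 1) C 2    ≡⟨ cong (_+ (r + 1) C 2) (trans (nC1≡n (r + 1)) (ℕ.+-comm r 1)) ⟩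
  suc r + (r + 1) C 2          ≡⟨ ℕ.+-comm (suc r) _ ⟩
  (r + 1) C 2 + suc r          ∎
  where open ≡-Reasoning

-- iteratedSum r j = (r + j) C r
iteratedSum : ℕ → ℕ → ℕ
iteratedSum zero j = 1
iteratedSum (suc r) j = sumTo j (iteratedSum r)

iteratedSum-0 : ∀ r → iteratedSum r 0 ≡ 1
iteratedSum-0 zero = refl
iteratedSum-0 (suc r) = iteratedSum-0 r

iteratedSum-1 : ∀ k → iteratedSum 1 k ≡ suc k
iteratedSum-1 k = trans (sumTo-const k 1) (ℕ.*-identityʳ (suc k))

iteratedSumBelow : ℕ → ℕ → ℕ
iteratedSumBelow r zero = 0
iteratedSumBelow r (suc k) = iteratedSum (suc r) k

iteratedSumBelow-0 : ∀ k → iteratedSumBelow 0 k ≡ k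
iteratedSumBelow-0 zero = refl
iteratedSumBelow-0 (suc k) = iteratedSum-1 k

iteratedSum-pascal : ∀ r k → iteratedSum (suc (suc r)) k ≡ iteratedSum (suc r) k + iteratedSumBelow (suc r) k
iteratedSum-pascal r zero =
  trans (iteratedSum-0 (suc (suc r))) (sym (trans (ℕ.+-identityʳ _) (iteratedSum-0 (suc r))))
iteratedSum-pascal r (suc k) = ℕ.+-comm (iteratedSum (suc (suc r)) k) (iteratedSum (suc r) (suc k))

doubling : (h : ℕ → ℕ → ℕ) → (∀ k → h 0 k ≡ 1) →
  (∀ r k → h (suc r) k ≡ iteratedSum (suc r) k + h r (suc k)) → ∀ n → h n 0 ≡ 2 ^ n
doubling h h-zero h-suc zero = h-zero 0
doubling h h-zero h-suc (suc n) =
  trans (twice n 0) (trans (ℕ.+-identityʳ _) (cong (2 *_) (doubling h h-zero h-suc n)))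
  where
  twice : ∀ r k → h (suc r) k ≡ 2 * h r k + iteratedSumBelow r k
  twice zero k = begin
    h 1 k
      ≡⟨ h-suc 0 k ⟩
    iteratedSum 1 k + h 0 (suc k)
      ≡⟨ cong₂ _+_ (iteratedSum-1 k) (h-zero (suc k)) ⟩
    suc k + 1
      ≡⟨ rearrange k ⟩
    2 * 1 + k
      ≡⟨ cong₂ (λ x y → 2 * x + y) (sym (h-zero k)) (sym (iteratedSumBelow-0 k)) ⟩
    2 * h 0 k + iteratedSumBelow 0 k ∎
    where
    open ≡-Reasoning
    rearrange : ∀ k → suc k + 1 ≡ 2 * 1 + k
    rearrange = solve-∀
  twice (suc r) k = begin
    h (suc (suc r)) k
      ≡⟨ h-suc (suc r) k ⟩
    iteratedSum (suc (suc r)) k + h (suc r) (suc k)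
      ≡⟨ cong₂ _+_ (iteratedSum-pascal r k) (twice r (suc k)) ⟩
    (iteratedSum (suc r) k + iteratedSumBelow (suc r) k) + (2 * h r (suc k) + iteratedSum (suc r) k)
      ≡⟨ rearrange (iteratedSum (suc r) k) (iteratedSumBelow (suc r) k) (h r (suc k)) ⟩
    2 * (iteratedSum (suc r) k + h r (suc k)) + iteratedSumBelow (suc r) k
      ≡⟨ cong (λ x → 2 * x + iteratedSumBelow (suc r) k) (sym (h-suc r k)) ⟩
    2 * h (suc r) k + iteratedSumBelow (suc r) k ∎
    where
    open ≡-Reasoning
    rearrange : ∀ a b c → (a + b) + (2 * c + a) ≡ 2 * (a + c) + b
    rearrange = solve-∀

-- Insertions into words made of blocks

trues falses : ℕ → List Bool
trues k = replicate k true
falses k = replicate k false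

replicate-++-∷ : ∀ {A : Set} k (c : A) w → replicate k c ++ c ∷ w ≡ c ∷ replicate k c ++ w
replicate-++-∷ zero c w = refl
replicate-++-∷ (suc k) c w = cong (c ∷_) (replicate-++-∷ k c w)

replicate-snoc : ∀ {A : Set} k (c : A) → replicate k c ++ c ∷ [] ≡ replicate (suc k) c
replicate-snoc k c = trans (replicate-++-∷ k c []) (cong (c ∷_) (L.++-identityʳ (replicate k c)))

replicate-join : ∀ {A : Set} p q (c : A) → replicate p c ++ c ∷ replicate q c ≡ replicate (suc (p + q)) c
replicate-join zero q c = refl
replicate-join (suc p) q c = cong (c ∷_) (replicate-join p q c)

replicate-join-++ : ∀ {A : Set} p q (c : A) w →
  replicate p c ++ c ∷ replicate q c ++ w ≡ replicate (suc (p + q)) c ++ w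
replicate-join-++ p q c w =
  trans (sym (L.++-assoc (replicate p c) (c ∷ replicate q c) w)) (cong (_++ w) (replicate-join p q c))

all-≡false : ∀ (R : Bool → Bool) {c} w → c ∈ w → R c ≡ false → all R w ≡ false
all-≡false R (x ∷ w) (here refl) Rc≡false rewrite Rc≡false = refl
all-≡false R (x ∷ w) (there c∈w) Rc≡false with R x
... | true = all-≡false R w c∈w Rc≡false
... | false = refl

all-replicate-++ : ∀ (R : Bool → Bool) {c} k w → R c ≡ true → all R w ≡ true →
  all R (replicate k c ++ w) ≡ true
all-replicate-++ R zero w _ Rw≡true = Rw≡true
all-replicate-++ R (suc k) w Rc≡true Rw≡true rewrite Rc≡true = all-replicate-++ R k w Rc≡true Rw≡true

all-replicate : ∀ (R : Bool → Bool) {c} k → R c ≡ true → all R (replicate k c) ≡ true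
all-replicate R k Rc≡true =
  subst (λ w → all R w ≡ true) (L.++-identityʳ (replicate k _)) (all-replicate-++ R k [] Rc≡true refl)

all-always : ∀ (R : Bool → Bool) w → (∀ s → R s ≡ true) → all R w ≡ true
all-always R [] _ = refl
all-always R (x ∷ w) always rewrite always x = all-always R w always

∀-Bool : ∀ {f : Bool → Bool} {v} → f false ≡ v → f true ≡ v → ∀ s → f s ≡ v
∀-Bool f-false _ false = f-false
∀-Bool _ f-true true = f-true

module SumValid (L R : Bool → Bool) (b : Bool) where

  vanishes : ∀ {c} f w → c ∈ w → L c ≡ false → R c ≡ false → sumValid L R b f w ≡ 0
  vanishes f (x ∷ w) (here refl) Lc≡false Rc≡false rewrite Rc≡false | Lc≡false = refl
  vanishes f (x ∷ w) (there c∈w) Lc≡false Rc≡false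
    rewrite all-≡false R (x ∷ w) (there c∈w) Rc≡false with L x
  ... | true = vanishes (λ w′ → f (x ∷ w′)) w c∈w Lc≡false Rc≡false
  ... | false = refl

  head-vanishes : ∀ f x w → L x ≡ false → all R (x ∷ w) ≡ false → sumValid L R b f (x ∷ w) ≡ 0
  head-vanishes f x w Lx≡false blocked rewrite blocked | Lx≡false = refl

  private
    onlyHead : ∀ f x w → L x ≡ false → all R (x ∷ w) ≡ true → sumValid L R b f (x ∷ w) ≡ f (b ∷ x ∷ w)
    onlyHead f x w Lx≡false open′ rewrite open′ | Lx≡false = ℕ.+-identityʳ _

  head : ∀ f x w → L x ≡ false → (∀ s → R s ≡ true) → sumValid L R b f (x ∷ w) ≡ f (b ∷ x ∷ w)
  head f x w Lx≡false always = onlyHead f x w Lx≡false (all-always R (x ∷ w) always)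

  front : ∀ f w → (∀ s → L s ≡ false) → (∀ s → R s ≡ true) → sumValid L R b f w ≡ f (b ∷ w)
  front f [] _ _ = refl
  front f (x ∷ w) never always = head f x w (never x) always

  front-replicate : ∀ c k f → (∀ s → L s ≡ false) → R c ≡ true →
    sumValid L R b f (replicate k c) ≡ f (b ∷ replicate k c)
  front-replicate c zero f _ _ = refl
  front-replicate c (suc k) f never Rc≡true =
    onlyHead f c (replicate k c) (never c) (all-replicate R (suc k) Rc≡true)

  skip : ∀ c → L c ≡ true → R c ≡ false → ∀ k f w →
    sumValid L R b f (replicate k c ++ w) ≡ sumValid L R b (λ w′ → f (replicate k c ++ w′)) w
  skip c Lc≡true Rc≡false zero f w = refl
  skip c Lc≡true Rc≡false (suc k) f w rewrite Rc≡false | Lc≡true =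
    skip c Lc≡true Rc≡false k (λ w′ → f (c ∷ w′)) w

  split : ∀ c d → L c ≡ true → R c ≡ false → L d ≡ false → R d ≡ true → ∀ j m f →
    sumValid L R b f (replicate j c ++ replicate m d) ≡ f (replicate j c ++ b ∷ replicate m d)
  split c d Lc≡true Rc≡false Ld≡false Rd≡true j m f =
    trans (skip c Lc≡true Rc≡false j f (replicate m d)) (onlyFirst m)
    where
    onlyFirst : ∀ m → sumValid L R b (λ w → f (replicate j c ++ w)) (replicate m d)
                      ≡ f (replicate j c ++ b ∷ replicate m d)
    onlyFirst zero = refl
    onlyFirst (suc m) =
      onlyHead (λ w → f (replicate j c ++ w)) d (replicate m d) Ld≡false (all-replicate R (suc m) Rd≡true)

  end : ∀ c → L c ≡ true → R c ≡ false → ∀ k f →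
    sumValid L R b f (replicate k c) ≡ f (replicate k c ++ b ∷ [])
  end c Lc≡true Rc≡false k f =
    trans (cong (sumValid L R b f) (sym (L.++-identityʳ (replicate k c)))) (skip c Lc≡true Rc≡false k f [])

  everywhere : ∀ c → L c ≡ true → R c ≡ true → ∀ w → all R w ≡ true → (∀ f → sumValid L R b f w ≡ f (b ∷ w)) →
    ∀ k f g → (∀ p q → p + q ≡ k → f (replicate p c ++ b ∷ replicate q c ++ w) ≡ g p) →
    sumValid L R b f (replicate k c ++ w) ≡ sumTo k g
  everywhere c Lc≡true Rc≡true w openW frontOnly zero f g value = trans (frontOnly f) (value 0 0 refl)
  everywhere c Lc≡true Rc≡true w openW frontOnly (suc k) f g value
    rewrite Rc≡true | all-replicate-++ R k w Rc≡true openW | Lc≡true = begin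
      f (b ∷ c ∷ replicate k c ++ w) + sumValid L R b (λ w′ → f (c ∷ w′)) (replicate k c ++ w)
        ≡⟨ cong₂ _+_ (value 0 (suc k) refl)
                     (everywhere c Lc≡true Rc≡true w openW frontOnly k _ (g ∘ suc)
                        λ p q p+q≡k → value (suc p) q (cong suc p+q≡k)) ⟩
      g 0 + sumTo k (g ∘ suc)
        ≡⟨ sym (sumTo-shift k g) ⟩
      sumTo (suc k) g ∎
    where open ≡-Reasoning

  const : ∀ c → L c ≡ true → R c ≡ true → ∀ k f v →
    (∀ p q → p + q ≡ k → f (replicate p c ++ b ∷ replicate q c) ≡ v) →
    sumValid L R b f (replicate k c) ≡ suc k * v
  const c Lc≡true Rc≡true k f v value = begin
    sumValid L R b f (replicate k c)
      ≡⟨ cong (sumValid L R b f) (sym (L.++-identityʳ (replicate k c))) ⟩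
    sumValid L R b f (replicate k c ++ [])
      ≡⟨ everywhere c Lc≡true Rc≡true [] refl (λ _ → refl) k f (λ _ → v) (λ p q p+q≡k →
           trans (cong (λ w → f (replicate p c ++ b ∷ w)) (L.++-identityʳ (replicate q c))) (value p q p+q≡k)) ⟩
    sumTo k (λ _ → v)
      ≡⟨ sumTo-const k v ⟩
    suc k * v ∎
    where open ≡-Reasoning

  block : L b ≡ true → R b ≡ true → ∀ k f → sumValid L R b f (replicate k b) ≡ suc k * f (replicate (suc k) b)
  block Lb≡true Rb≡true k f = const b Lb≡true Rb≡true k f _ λ p q p+q≡k →
    cong f (trans (replicate-join p q b) (cong (λ x → replicate (suc x) b) p+q≡k))

  block-++ : L b ≡ true → (∀ s → R s ≡ true) → ∀ w → (∀ f → sumValid L R b f w ≡ f (b ∷ w)) → ∀ k f →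
    sumValid L R b f (replicate k b ++ w) ≡ suc k * f (replicate (suc k) b ++ w)
  block-++ Lb≡true always w frontOnly k f =
    trans (everywhere b Lb≡true (always b) w (all-always R w always) frontOnly k f _ λ p q p+q≡k →
             cong f (trans (replicate-join-++ p q b w) (cong (λ x → replicate (suc x) b ++ w) p+q≡k)))
          (sumTo-const k _)

  last : ∀ c → L c ≡ true → R c ≡ true → ∀ k f →
    (∀ p q → f (replicate p c ++ b ∷ replicate (suc q) c) ≡ 0) →
    sumValid L R b f (replicate k c) ≡ f (replicate k c ++ b ∷ [])
  last c Lc≡true Rc≡true zero f _ = refl
  last c Lc≡true Rc≡true (suc k) f vanish rewrite Rc≡true | all-replicate R k Rc≡true | Lc≡true =
    cong₂ _+_ (vanish 0 k) (last c Lc≡true Rc≡true k (λ w → f (c ∷ w)) (λ p q → vanish (suc p) q))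

module Insertions (T : List Pattern2) (b : Bool) = SumValid (leftOk T b) (rightOk T b) b

-- The sixteen pattern sets

-- For each Uᵢ the hypotheses on leftOk Uᵢ b and rightOk Uᵢ b are closed Boolean equations, proved by refl.
U1 U2 U3 U4 U5 U6 U7 U8 U9 U10 U11 U12 U13 U14 U15 U16 : List Pattern2
U1 = pat u1 u2 ∷ pat u1 o2 ∷ pat o1 u2 ∷ pat o1 o2 ∷ []
U2 = pat u1 u2 ∷ pat u1 o2 ∷ pat o1 u2 ∷ pat u2 u1 ∷ []
U3 = pat u1 u2 ∷ pat u1 o2 ∷ pat o1 u2 ∷ pat u2 o1 ∷ []
U4 = pat u1 u2 ∷ pat u1 o2 ∷ pat o1 u2 ∷ pat o2 o1 ∷ []
U5 = pat u1 u2 ∷ pat u1 o2 ∷ pat o1 o2 ∷ pat u2 u1 ∷ []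
U6 = pat u1 u2 ∷ pat u1 o2 ∷ pat o1 o2 ∷ pat u2 o1 ∷ []
U7 = pat u1 u2 ∷ pat u1 o2 ∷ pat o1 o2 ∷ pat o2 u1 ∷ []
U8 = pat u1 u2 ∷ pat u1 o2 ∷ pat u2 u1 ∷ pat u2 o1 ∷ []
U9 = pat u1 u2 ∷ pat u1 o2 ∷ pat u2 u1 ∷ pat o2 u1 ∷ []
U10 = pat u1 u2 ∷ pat u1 o2 ∷ pat u2 u1 ∷ pat o2 o1 ∷ []
U11 = pat u1 u2 ∷ pat u1 o2 ∷ pat u2 o1 ∷ pat o2 u1 ∷ []
U12 = pat u1 u2 ∷ pat u1 o2 ∷ pat u2 o1 ∷ pat o2 o1 ∷ []
U13 = pat u1 u2 ∷ pat u1 o2 ∷ pat o2 u1 ∷ pat o2 o1 ∷ []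
U14 = pat u1 u2 ∷ pat o1 o2 ∷ pat u2 u1 ∷ pat o2 o1 ∷ []
U15 = pat u1 u2 ∷ pat o1 o2 ∷ pat u2 o1 ∷ pat o2 u1 ∷ []
U16 = pat u1 o2 ∷ pat o1 u2 ∷ pat u2 o1 ∷ pat o2 u1 ∷ []

U1-any : ∀ r w → descendants U1 r w ≡ 2 ^ r
U1-any zero w = refl
U1-any (suc r) w = begin
  insertions U1 false (descendants U1 r) w + insertions U1 true (descendants U1 r) w
    ≡⟨ cong₂ _+_ (Insertions.front U1 false (descendants U1 r) w (∀-Bool refl refl) (∀-Bool refl refl))
                 (Insertions.front U1 true (descendants U1 r) w (∀-Bool refl refl) (∀-Bool refl refl)) ⟩
  descendants U1 r (false ∷ w) + descendants U1 r (true ∷ w)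
    ≡⟨ cong₂ _+_ (U1-any r _) (U1-any r _) ⟩
  2 ^ r + 2 ^ r
    ≡⟨ double (2 ^ r) ⟩
  2 ^ suc r ∎
  where open ≡-Reasoning

U1-count : ∀ n → descendants U1 n [] ≡ 2 ^ n
U1-count n = U1-any n []

U2-trues-false-trues : ∀ r j m → descendants U2 r (trues j ++ false ∷ trues m) ≡ rising j r
U2-trues-false-trues zero j m = refl
U2-trues-false-trues (suc r) j m = cong₂ _+_
  (Insertions.vanishes U2 false (descendants U2 r) w (∈.∈-++⁺ʳ (trues j) (here refl)) refl refl)
  (trans (Insertions.block-++ U2 true refl (∀-Bool refl refl) (false ∷ trues m)
            (λ f → Insertions.head U2 true f false (trues m) refl (∀-Bool refl refl)) j (descendants U2 r))
         (cong (suc j *_) (U2-trues-false-trues r (suc j) m)))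
  where
  w : List Bool
  w = trues j ++ false ∷ trues m

U2-trues-step : ∀ r k → descendants U2 (suc r) (trues k) ≡ r ! + suc k * descendants U2 r (trues (suc k))
U2-trues-step r k = cong₂ _+_
  (trans (Insertions.front-replicate U2 false true k (descendants U2 r) (∀-Bool refl refl) refl)
         (trans (U2-trues-false-trues r 0 k) (rising-0 r)))
  (Insertions.block U2 true refl refl k (descendants U2 r))

U2-trues : ∀ r k → descendants U2 r (trues k) ≡ rising k r + sumBelow r (λ i → rising k i * (r ∸ 1 ∸ i) !)
U2-trues zero k = refl
U2-trues (suc r) k = begin
  descendants U2 (suc r) (trues k)
    ≡⟨ U2-trues-step r k ⟩
  r ! + suc k * descendants U2 r (trues (suc k))
    ≡⟨ cong (λ x → r ! + suc k * x) (U2-trues r (suc k)) ⟩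
  r ! + suc k * (rising (suc k) r + S)
    ≡⟨ rearrange (r !) (suc k) (rising (suc k) r) S ⟩
  suc k * rising (suc k) r + (1 * r ! + suc k * S)
    ≡⟨ cong (λ x → suc k * rising (suc k) r + (1 * r ! + x)) (sym (sumBelow-* r (suc k) _)) ⟩
  suc k * rising (suc k) r + (1 * r ! + sumBelow r (λ i → suc k * (rising (suc k) i * (r ∸ 1 ∸ i) !)))
    ≡⟨ cong (λ x → suc k * rising (suc k) r + (1 * r ! + x)) (sumBelow-cong r reindex) ⟩
  suc k * rising (suc k) r + (1 * r ! + sumBelow r (λ i → rising k (suc i) * (suc r ∸ 1 ∸ suc i) !))
    ≡⟨ cong (suc k * rising (suc k) r +_) (sym (sumBelow-shift r (λ i → rising k i * (suc r ∸ 1 ∸ i) !))) ⟩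
  rising k (suc r) + sumBelow (suc r) (λ i → rising k i * (suc r ∸ 1 ∸ i) !) ∎
  where
  open ≡-Reasoning
  S : ℕ
  S = sumBelow r (λ i → rising (suc k) i * (r ∸ 1 ∸ i) !)
  rearrange : ∀ a b c d → a + b * (c + d) ≡ b * c + (1 * a + b * d)
  rearrange = solve-∀
  reindex : ∀ i → suc k * (rising (suc k) i * (r ∸ 1 ∸ i) !) ≡ rising k (suc i) * (r ∸ suc i) !
  reindex i = trans (sym (ℕ.*-assoc (suc k) (rising (suc k) i) ((r ∸ 1 ∸ i) !)))
                    (cong (λ x → suc k * rising (suc k) i * x !) (ℕ.∸-+-assoc r 1 i))

U2-count : ∀ n → descendants U2 n [] ≡ n ! + sumBelow n (λ j → j ! * (n ∸ 1 ∸ j) !)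
U2-count n =
  trans (U2-trues n 0) (cong₂ _+_ (rising-0 n) (sumBelow-cong n λ i → cong (_* (n ∸ 1 ∸ i) !) (rising-0 i)))

U3-front : ∀ m f → insertions U3 true f (falses m) ≡ f (true ∷ falses m)
U3-front zero f = refl
U3-front (suc m) f = Insertions.head U3 true f false (falses m) refl (∀-Bool refl refl)

U3-trues-falses : ∀ r j m → descendants U3 r (trues (suc j) ++ falses m) ≡ rising (suc j) r
U3-trues-falses zero j m = refl
U3-trues-falses (suc r) j m = trans
  (Insertions.block-++ U3 true refl (∀-Bool refl refl) (falses m) (U3-front m)
     (suc j) (descendants U3 r))
  (cong (suc (suc j) *_) (U3-trues-falses r (suc j) m))

U3-falses : ∀ r m → descendants U3 r (falses m) ≡ sumTo r _!
U3-falses zero m = refl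
U3-falses (suc r) m = cong₂ _+_
  (trans (Insertions.front-replicate U3 false false m (descendants U3 r) (∀-Bool refl refl) refl)
         (U3-falses r (suc m)))
  (trans (U3-front m (descendants U3 r)) (trans (U3-trues-falses r 0 m) (rising-1 r)))

U3-count : ∀ n → descendants U3 n [] ≡ sumTo n _!
U3-count n = U3-falses n 0

U4-falses-trues-falses : ∀ r a j m → descendants U4 r (falses (suc a) ++ trues (suc j) ++ falses m) ≡ 1
U4-falses-trues-falses zero a j m = refl
U4-falses-trues-falses (suc r) a j m = cong₂ _+_
  (trans (Insertions.front U4 false (descendants U4 r) w (∀-Bool refl refl) (∀-Bool refl refl))
         (U4-falses-trues-falses r (suc a) j m))
  (Insertions.head-vanishes U4 true (descendants U4 r) false _ refl
    (all-≡false (rightOk U4 true) w (∈.∈-++⁺ʳ (falses (suc a)) (here refl)) refl))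
  where
  w : List Bool
  w = falses (suc a) ++ trues (suc j) ++ falses m

U4-trues-falses : ∀ r j m → descendants U4 r (trues (suc j) ++ falses m) ≡ suc r
U4-trues-falses zero j m = refl
U4-trues-falses (suc r) j m = cong₂ _+_
  (trans (Insertions.front U4 false (descendants U4 r) w (∀-Bool refl refl) (∀-Bool refl refl))
         (U4-falses-trues-falses r 0 j m))
  (trans (Insertions.split U4 true true false refl refl refl refl (suc j) m (descendants U4 r))
         (trans (cong (descendants U4 r) (replicate-++-∷ (suc j) true (falses m))) (U4-trues-falses r (suc j) m)))
  where
  w : List Bool
  w = trues (suc j) ++ falses m

U4-falses : ∀ r m → descendants U4 r (falses m) ≡ 1 + (r + 1) C 2
U4-falses zero m = refl
U4-falses (suc r) m = begin
  insertions U4 false (descendants U4 r) (falses m) + insertions U4 true (descendants U4 r) (falses m)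
    ≡⟨ cong₂ _+_ (Insertions.front U4 false (descendants U4 r) (falses m) (∀-Bool refl refl) (∀-Bool refl refl))
                 (Insertions.split U4 true true false refl refl refl refl 0 m (descendants U4 r)) ⟩
  descendants U4 r (falses (suc m)) + descendants U4 r (trues 1 ++ falses m)
    ≡⟨ cong₂ _+_ (U4-falses r (suc m)) (U4-trues-falses r 0 m) ⟩
  1 + (r + 1) C 2 + suc r
    ≡⟨ cong suc (sym (C2-suc r)) ⟩
  1 + (suc r + 1) C 2 ∎
  where open ≡-Reasoning

U4-count : ∀ n → descendants U4 n [] ≡ 1 + (n + 1) C 2
U4-count n = U4-falses n 0

U5-with-false : ∀ r w → false ∈ w → descendants U5 r w ≡ 1
U5-with-false zero w _ = refl
U5-with-false (suc r) w false∈w = cong₂ _+_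
  (Insertions.vanishes U5 false (descendants U5 r) w false∈w refl refl)
  (trans (Insertions.front U5 true (descendants U5 r) w (∀-Bool refl refl) (∀-Bool refl refl))
         (U5-with-false r (true ∷ w) (there false∈w)))

U5-trues : ∀ r k → descendants U5 r (trues k) ≡ 1 + (r * k + (r + 1) C 2)
U5-trues zero k = refl
U5-trues (suc r) k = begin
  insertions U5 false (descendants U5 r) (trues k) + insertions U5 true (descendants U5 r) (trues k)
    ≡⟨ cong₂ _+_ (Insertions.const U5 false true refl refl k (descendants U5 r) 1 λ p q _ →
                    U5-with-false r (trues p ++ false ∷ trues q) (∈.∈-++⁺ʳ (trues p) (here refl)))
                 (trans (Insertions.front U5 true (descendants U5 r) (trues k) (∀-Bool refl refl) (∀-Bool refl refl))
                        (U5-trues r (suc k))) ⟩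
  suc k * 1 + (1 + (r * suc k + (r + 1) C 2))
    ≡⟨ rearrange k r ((r + 1) C 2) ⟩
  1 + (suc r * k + ((r + 1) C 2 + suc r))
    ≡⟨ cong (λ x → 1 + (suc r * k + x)) (sym (C2-suc r)) ⟩
  1 + (suc r * k + (suc r + 1) C 2) ∎
  where
  open ≡-Reasoning
  rearrange : ∀ k r x → suc k * 1 + (1 + (r * suc k + x)) ≡ 1 + (suc r * k + (x + suc r))
  rearrange = solve-∀

U5-count : ∀ n → descendants U5 n [] ≡ 1 + (n + 1) C 2
U5-count n = trans (U5-trues n 0) (cong (λ x → 1 + (x + (n + 1) C 2)) (ℕ.*-zeroʳ n))

U6-trues-falses : ∀ r j m → descendants U6 r (trues j ++ falses m) ≡ 2 ^ r
U6-trues-falses zero j m = refl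
U6-trues-falses (suc r) j m = begin
  insertions U6 false (descendants U6 r) w + insertions U6 true (descendants U6 r) w
    ≡⟨ cong₂ _+_ (Insertions.split U6 false true false refl refl refl refl j m (descendants U6 r))
                 (Insertions.front U6 true (descendants U6 r) w (∀-Bool refl refl) (∀-Bool refl refl)) ⟩
  descendants U6 r (trues j ++ falses (suc m)) + descendants U6 r (trues (suc j) ++ falses m)
    ≡⟨ cong₂ _+_ (U6-trues-falses r j (suc m)) (U6-trues-falses r (suc j) m) ⟩
  2 ^ r + 2 ^ r
    ≡⟨ double (2 ^ r) ⟩
  2 ^ suc r ∎
  where
  open ≡-Reasoning
  w : List Bool
  w = trues j ++ falses m

U6-count : ∀ n → descendants U6 n [] ≡ 2 ^ n
U6-count n = U6-trues-falses n 0 0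

module BarredPrefix (T : List Pattern2)
  (12∈T : leftOk T false false ≡ false) (1̄2∉T : leftOk T false true ≡ true)
  (2s∉T : ∀ s → rightOk T false s ≡ true)
  (12̄∈T : leftOk T true false ≡ false) (2̄1∈T : rightOk T true false ≡ false) where

  trues-false : ∀ r j w → descendants T r (trues j ++ false ∷ w) ≡ iteratedSum r j
  trues-false zero j w = refl
  trues-false (suc r) j w = trans (cong₂ _+_
    (Insertions.everywhere T false true 1̄2∉T (2s∉T true) (false ∷ w) (all-always (rightOk T false) (false ∷ w) 2s∉T)
       (λ f → Insertions.head T false f false w 12∈T 2s∉T)
       j (descendants T r) (iteratedSum r) (λ p q _ → trues-false r p (trues q ++ false ∷ w)))
    (Insertions.vanishes T true (descendants T r) (trues j ++ false ∷ w) (∈.∈-++⁺ʳ (trues j) (here refl))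
       12̄∈T 2̄1∈T))
    (ℕ.+-identityʳ _)

  unbarred-trues : ∀ r k → insertions T false (descendants T r) (trues k) ≡ iteratedSum (suc r) k
  unbarred-trues r k = trans (cong (insertions T false (descendants T r)) (sym (L.++-identityʳ (trues k))))
    (Insertions.everywhere T false true 1̄2∉T (2s∉T true) [] refl (λ _ → refl) k (descendants T r) (iteratedSum r)
       (λ p q _ → trues-false r p (trues q ++ [])))

U7-trues-step : ∀ r k →
  descendants U7 (suc r) (trues k) ≡ iteratedSum (suc r) k + descendants U7 r (trues (suc k))
U7-trues-step r k = cong₂ _+_
  (BarredPrefix.unbarred-trues U7 refl refl (∀-Bool refl refl) refl refl r k)
  (Insertions.front-replicate U7 true true k (descendants U7 r) (∀-Bool refl refl) refl)

U7-count : ∀ n → descendants U7 n [] ≡ 2 ^ n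
U7-count = doubling (λ r k → descendants U7 r (trues k)) (λ _ → refl) U7-trues-step

U8-trues-false : ∀ r k → descendants U8 r (trues k ++ false ∷ []) ≡ rising k r
U8-trues-false zero k = refl
U8-trues-false (suc r) k = cong₂ _+_
  (Insertions.vanishes U8 false (descendants U8 r) (trues k ++ false ∷ []) (∈.∈-++⁺ʳ (trues k) (here refl))
     refl refl)
  (trans (Insertions.block-++ U8 true refl (∀-Bool refl refl) (false ∷ [])
            (λ f → Insertions.head U8 true f false [] refl (∀-Bool refl refl)) k (descendants U8 r))
         (cong (suc k *_) (U8-trues-false r (suc k))))

U8-trues-step : ∀ r k → descendants U8 (suc r) (trues k) ≡ rising k r + suc k * descendants U8 r (trues (suc k))
U8-trues-step r k = cong₂ _+_
  (trans (Insertions.end U8 false true refl refl k (descendants U8 r)) (U8-trues-false r k))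
  (Insertions.block U8 true refl refl k (descendants U8 r))

U8-trues : ∀ r k → descendants U8 (suc r) (trues k) ≡ rising k (suc r) + suc r * rising k r
U8-trues zero k = trans (U8-trues-step 0 k) (rearrange k)
  where
  rearrange : ∀ k → 1 + suc k * 1 ≡ suc k * 1 + 1 * 1
  rearrange = solve-∀
U8-trues (suc r) k = begin
  descendants U8 (suc (suc r)) (trues k)
    ≡⟨ U8-trues-step (suc r) k ⟩
  rising k (suc r) + suc k * descendants U8 (suc r) (trues (suc k))
    ≡⟨ cong (λ x → rising k (suc r) + suc k * x) (U8-trues r (suc k)) ⟩
  suc k * rising (suc k) r + suc k * (rising (suc k) (suc r) + suc r * rising (suc k) r)
    ≡⟨ rearrange (suc k) (rising (suc k) (suc r)) (rising (suc k) r) r ⟩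
  rising k (suc (suc r)) + suc (suc r) * rising k (suc r) ∎
  where
  open ≡-Reasoning
  rearrange : ∀ K a b r → K * b + K * (a + suc r * b) ≡ K * a + suc (suc r) * (K * b)
  rearrange = solve-∀

U8-count : ∀ r → descendants U8 (suc r) [] ≡ 2 * suc r !
U8-count r =
  trans (U8-trues r 0) (trans (cong₂ _+_ (rising-0 (suc r)) (cong (suc r *_) (rising-0 r))) (double (suc r !)))

U9-with-false : ∀ r w → false ∈ w → descendants U9 (suc r) w ≡ 0
U9-with-false r w false∈w = cong₂ _+_
  (Insertions.vanishes U9 false (descendants U9 r) w false∈w refl refl)
  (Insertions.vanishes U9 true (descendants U9 r) w false∈w refl refl)

U9-trues : ∀ r k → descendants U9 (suc r) (trues k) ≡ 2 * rising k (suc r)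
U9-trues zero k = trans (cong₂ _+_
  (Insertions.const U9 false true refl refl k (descendants U9 0) 1 (λ _ _ _ → refl))
  (Insertions.block U9 true refl refl k (descendants U9 0)))
  (double (suc k * 1))
U9-trues (suc r) k = begin
  insertions U9 false (descendants U9 (suc r)) (trues k) + insertions U9 true (descendants U9 (suc r)) (trues k)
    ≡⟨ cong₂ _+_ (Insertions.const U9 false true refl refl k (descendants U9 (suc r)) 0 λ p q _ →
                    U9-with-false r (trues p ++ false ∷ trues q) (∈.∈-++⁺ʳ (trues p) (here refl)))
                 (Insertions.block U9 true refl refl k (descendants U9 (suc r))) ⟩
  suc k * 0 + suc k * descendants U9 (suc r) (trues (suc k))
    ≡⟨ cong (λ x → suc k * 0 + suc k * x) (U9-trues r (suc k)) ⟩
  suc k * 0 + suc k * (2 * rising (suc k) (suc r))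
    ≡⟨ rearrange (suc k) (rising (suc k) (suc r)) ⟩
  2 * rising k (suc (suc r)) ∎
  where
  open ≡-Reasoning
  rearrange : ∀ K a → K * 0 + K * (2 * a) ≡ 2 * (K * a)
  rearrange = solve-∀

U9-count : ∀ r → descendants U9 (suc r) [] ≡ 2 * suc r !
U9-count r = trans (U9-trues r 0) (cong (2 *_) (rising-0 (suc r)))

U10-trues-false : ∀ r j → descendants U10 r (trues j ++ false ∷ []) ≡ 1
U10-trues-false zero j = refl
U10-trues-false (suc r) j = cong₂ _+_
  (Insertions.vanishes U10 false (descendants U10 r) w (∈.∈-++⁺ʳ (trues j) (here refl)) refl refl)
  (begin
    insertions U10 true (descendants U10 r) (trues j ++ falses 1)
      ≡⟨ Insertions.split U10 true true false refl refl refl refl j 1 (descendants U10 r) ⟩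
    descendants U10 r (trues j ++ true ∷ false ∷ [])
      ≡⟨ cong (descendants U10 r) (replicate-++-∷ j true (false ∷ [])) ⟩
    descendants U10 r (trues (suc j) ++ false ∷ [])
      ≡⟨ U10-trues-false r (suc j) ⟩
    1 ∎)
  where
  open ≡-Reasoning
  w : List Bool
  w = trues j ++ false ∷ []

U10-trues-false-trues : ∀ r j m → descendants U10 (suc r) (trues j ++ false ∷ trues (suc m)) ≡ 0
U10-trues-false-trues r j m = cong₂ _+_
  (Insertions.vanishes U10 false (descendants U10 r) w (∈.∈-++⁺ʳ (trues j) (here refl)) refl refl)
  (trans (Insertions.skip U10 true true refl refl j (descendants U10 r) (false ∷ trues (suc m)))
         (Insertions.head-vanishes U10 true (λ w′ → descendants U10 r (trues j ++ w′)) false (trues (suc m))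
            refl refl))
  where
  w : List Bool
  w = trues j ++ false ∷ trues (suc m)

U10-barred : ∀ r k → insertions U10 true (descendants U10 r) (trues k) ≡ descendants U10 r (trues (suc k))
U10-barred r k =
  trans (Insertions.end U10 true true refl refl k (descendants U10 r)) (cong (descendants U10 r) (replicate-snoc k true))

U10-trues : ∀ r k → descendants U10 (suc r) (trues k) ≡ k + 2 * suc r
U10-trues zero k = begin
  insertions U10 false (descendants U10 0) (trues k) + insertions U10 true (descendants U10 0) (trues k)
    ≡⟨ cong₂ _+_ (Insertions.const U10 false true refl refl k (descendants U10 0) 1 (λ _ _ _ → refl))
                 (U10-barred 0 k) ⟩
  suc k * 1 + 1
    ≡⟨ rearrange k ⟩
  k + 2 * 1 ∎
  where
  open ≡-Reasoning
  rearrange : ∀ k → suc k * 1 + 1 ≡ k + 2 * 1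
  rearrange = solve-∀
U10-trues (suc r) k = begin
  insertions U10 false (descendants U10 (suc r)) (trues k) + insertions U10 true (descendants U10 (suc r)) (trues k)
    ≡⟨ cong₂ _+_ (Insertions.last U10 false true refl refl k (descendants U10 (suc r)) (U10-trues-false-trues r))
                 (U10-barred (suc r) k) ⟩
  descendants U10 (suc r) (trues k ++ false ∷ []) + descendants U10 (suc r) (trues (suc k))
    ≡⟨ cong₂ _+_ (U10-trues-false (suc r) k) (U10-trues r (suc k)) ⟩
  1 + (suc k + 2 * suc r)
    ≡⟨ rearrange k r ⟩
  k + 2 * suc (suc r) ∎
  where
  open ≡-Reasoning
  rearrange : ∀ k r → 1 + (suc k + 2 * suc r) ≡ k + 2 * suc (suc r)
  rearrange = solve-∀

U10-count : ∀ r → descendants U10 (suc r) [] ≡ 2 * suc r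
U10-count r = U10-trues r 0

U11-trues-falses : ∀ r j m → descendants U11 r (trues j ++ falses (suc m)) ≡ 1
U11-trues-falses zero j m = refl
U11-trues-falses (suc r) j m = trans (cong₂ _+_
  (trans (Insertions.split U11 false true false refl refl refl refl j (suc m) (descendants U11 r))
         (U11-trues-falses r j (suc m)))
  (Insertions.vanishes U11 true (descendants U11 r) w (∈.∈-++⁺ʳ (trues j) (here refl)) refl refl))
  (ℕ.+-identityʳ 1)
  where
  w : List Bool
  w = trues j ++ falses (suc m)

U11-trues : ∀ r k → descendants U11 r (trues k) ≡ sumTo r (rising k)
U11-trues zero k = refl
U11-trues (suc r) k = begin
  insertions U11 false (descendants U11 r) (trues k) + insertions U11 true (descendants U11 r) (trues k)
    ≡⟨ cong₂ _+_ (Insertions.end U11 false true refl refl k (descendants U11 r))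
                 (Insertions.block U11 true refl refl k (descendants U11 r)) ⟩
  descendants U11 r (trues k ++ falses 1) + suc k * descendants U11 r (trues (suc k))
    ≡⟨ cong₂ (λ x y → x + suc k * y) (U11-trues-falses r k 0) (U11-trues r (suc k)) ⟩
  1 + suc k * sumTo r (rising (suc k))
    ≡⟨ sym (sumTo-rising-suc r k) ⟩
  sumTo (suc r) (rising k) ∎
  where open ≡-Reasoning

U11-count : ∀ n → descendants U11 n [] ≡ sumTo n _!
U11-count n = trans (U11-trues n 0) (sumTo-cong n rising-0)

U12-trues-falses : ∀ r j m → descendants U12 r (trues j ++ falses m) ≡ 2 ^ r
U12-trues-falses zero j m = refl
U12-trues-falses (suc r) j m = begin
  insertions U12 false (descendants U12 r) w + insertions U12 true (descendants U12 r) w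
    ≡⟨ cong₂ _+_ (Insertions.split U12 false true false refl refl refl refl j m (descendants U12 r))
                 (Insertions.split U12 true true false refl refl refl refl j m (descendants U12 r)) ⟩
  descendants U12 r (trues j ++ falses (suc m)) + descendants U12 r (trues j ++ true ∷ falses m)
    ≡⟨ cong (λ w′ → descendants U12 r (trues j ++ falses (suc m)) + descendants U12 r w′)
            (replicate-++-∷ j true (falses m)) ⟩
  descendants U12 r (trues j ++ falses (suc m)) + descendants U12 r (trues (suc j) ++ falses m)
    ≡⟨ cong₂ _+_ (U12-trues-falses r j (suc m)) (U12-trues-falses r (suc j) m) ⟩
  2 ^ r + 2 ^ r
    ≡⟨ double (2 ^ r) ⟩
  2 ^ suc r ∎
  where
  open ≡-Reasoning
  w : List Bool
  w = trues j ++ falses m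

U12-count : ∀ n → descendants U12 n [] ≡ 2 ^ n
U12-count n = U12-trues-falses n 0 0

U13-trues-step : ∀ r k →
  descendants U13 (suc r) (trues k) ≡ iteratedSum (suc r) k + descendants U13 r (trues (suc k))
U13-trues-step r k = cong₂ _+_
  (BarredPrefix.unbarred-trues U13 refl refl (∀-Bool refl refl) refl refl r k)
  (trans (Insertions.end U13 true true refl refl k (descendants U13 r))
         (cong (descendants U13 r) (replicate-snoc k true)))

U13-count : ∀ n → descendants U13 n [] ≡ 2 ^ n
U13-count = doubling (λ r k → descendants U13 r (trues k)) (λ _ → refl) U13-trues-step

U14-mixed : ∀ r w → false ∈ w → true ∈ w → descendants U14 (suc r) w ≡ 0
U14-mixed r w false∈w true∈w =
  cong₂ _+_ (Insertions.vanishes U14 false (descendants U14 r) w false∈w refl refl)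
            (Insertions.vanishes U14 true (descendants U14 r) w true∈w refl refl)

U14-singleton : ∀ r c → descendants U14 (suc (suc r)) (c ∷ []) ≡ 0
U14-singleton r false = cong₂ _+_
  (Insertions.vanishes U14 false (descendants U14 (suc r)) (false ∷ []) (here refl) refl refl)
  (cong₂ _+_ (U14-mixed r (true ∷ false ∷ []) (there (here refl)) (here refl))
             (U14-mixed r (false ∷ true ∷ []) (here refl) (there (here refl))))
U14-singleton r true = cong₂ _+_
  (cong₂ _+_ (U14-mixed r (false ∷ true ∷ []) (here refl) (there (here refl)))
             (U14-mixed r (true ∷ false ∷ []) (there (here refl)) (here refl)))
  (Insertions.vanishes U14 true (descendants U14 (suc r)) (true ∷ []) (here refl) refl refl)

U14-count : ∀ r → descendants U14 (suc (suc (suc r))) [] ≡ 0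
U14-count r = cong₂ _+_ (U14-singleton r false) (U14-singleton r true)

U15-falses-trues : ∀ r a b → descendants U15 r (falses (suc a) ++ trues (suc b)) ≡ 1
U15-falses-trues zero a b = refl
U15-falses-trues (suc r) a b = cong₂ _+_
  (Insertions.head-vanishes U15 false (descendants U15 r) false (falses a ++ trues (suc b)) refl
     (all-≡false (rightOk U15 false) w (∈.∈-++⁺ʳ (falses (suc a)) (here refl)) refl))
  (trans (Insertions.split U15 true false true refl refl refl refl (suc a) (suc b) (descendants U15 r))
         (U15-falses-trues r a (suc b)))
  where
  w : List Bool
  w = falses (suc a) ++ trues (suc b)

U15-trues-falses : ∀ r a b → descendants U15 r (trues (suc b) ++ falses (suc a)) ≡ 1
U15-trues-falses zero a b = refl
U15-trues-falses (suc r) a b = trans (cong₂ _+_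
  (trans (Insertions.split U15 false true false refl refl refl refl (suc b) (suc a) (descendants U15 r))
         (U15-trues-falses r (suc a) b))
  (Insertions.head-vanishes U15 true (descendants U15 r) true (trues b ++ falses (suc a)) refl
     (all-≡false (rightOk U15 true) w (∈.∈-++⁺ʳ (trues (suc b)) (here refl)) refl)))
  (ℕ.+-identityʳ 1)
  where
  w : List Bool
  w = trues (suc b) ++ falses (suc a)

U15-falses : ∀ r a → descendants U15 r (falses (suc a)) ≡ suc r
U15-falses zero a = refl
U15-falses (suc r) a = trans (cong₂ _+_
  (trans (Insertions.split U15 false true false refl refl refl refl 0 (suc a) (descendants U15 r))
         (U15-falses r (suc a)))
  (trans (Insertions.end U15 true false refl refl (suc a) (descendants U15 r)) (U15-falses-trues r a 0)))
  (ℕ.+-comm (suc r) 1)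

U15-trues : ∀ r b → descendants U15 r (trues (suc b)) ≡ suc r
U15-trues zero b = refl
U15-trues (suc r) b = cong₂ _+_
  (trans (Insertions.end U15 false true refl refl (suc b) (descendants U15 r)) (U15-trues-falses r 0 b))
  (trans (Insertions.split U15 true false true refl refl refl refl 0 (suc b) (descendants U15 r))
         (U15-trues r (suc b)))

U15-count : ∀ r → descendants U15 (suc r) [] ≡ 2 * suc r
U15-count r = trans (cong₂ _+_ (U15-falses r 0) (U15-trues r 0)) (double (suc r))

U16-constant : ∀ r c k → descendants U16 r (replicate (suc k) c) ≡ rising (suc k) r
U16-constant zero c k = refl
U16-constant (suc r) false k = trans (cong₂ _+_
  (Insertions.block U16 false refl refl (suc k) (descendants U16 r))
  (Insertions.vanishes U16 true (descendants U16 r) (falses (suc k)) (here refl) refl refl))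
  (trans (ℕ.+-identityʳ _) (cong (suc (suc k) *_) (U16-constant r false (suc k))))
U16-constant (suc r) true k = cong₂ _+_
  (Insertions.vanishes U16 false (descendants U16 r) (trues (suc k)) (here refl) refl refl)
  (trans (Insertions.block U16 true refl refl (suc k) (descendants U16 r))
         (cong (suc (suc k) *_) (U16-constant r true (suc k))))

U16-count : ∀ r → descendants U16 (suc r) [] ≡ 2 * suc r !
U16-count r = trans (cong₂ _+_ (U16-constant r false 0) (U16-constant r true 0))
                    (trans (cong₂ _+_ (rising-1 r) (rising-1 r)) (double (suc r !)))

mainTheorem8 : ∀ (n : ℕ) → 3 ≤ n →
  let U1 = pat u1 u2 ∷ pat u1 o2 ∷ pat o1 u2 ∷ pat o1 o2 ∷ []
      U2 = pat u1 u2 ∷ pat u1 o2 ∷ pat o1 u2 ∷ pat u2 u1 ∷ []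
      U3 = pat u1 u2 ∷ pat u1 o2 ∷ pat o1 u2 ∷ pat u2 o1 ∷ []
      U4 = pat u1 u2 ∷ pat u1 o2 ∷ pat o1 u2 ∷ pat o2 o1 ∷ []
      U5 = pat u1 u2 ∷ pat u1 o2 ∷ pat o1 o2 ∷ pat u2 u1 ∷ []
      U6 = pat u1 u2 ∷ pat u1 o2 ∷ pat o1 o2 ∷ pat u2 o1 ∷ []
      U7 = pat u1 u2 ∷ pat u1 o2 ∷ pat o1 o2 ∷ pat o2 u1 ∷ []
      U8 = pat u1 u2 ∷ pat u1 o2 ∷ pat u2 u1 ∷ pat u2 o1 ∷ []
      U9 = pat u1 u2 ∷ pat u1 o2 ∷ pat u2 u1 ∷ pat o2 u1 ∷ []
      U10 = pat u1 u2 ∷ pat u1 o2 ∷ pat u2 u1 ∷ pat o2 o1 ∷ []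
      U11 = pat u1 u2 ∷ pat u1 o2 ∷ pat u2 o1 ∷ pat o2 u1 ∷ []
      U12 = pat u1 u2 ∷ pat u1 o2 ∷ pat u2 o1 ∷ pat o2 o1 ∷ []
      U13 = pat u1 u2 ∷ pat u1 o2 ∷ pat o2 u1 ∷ pat o2 o1 ∷ []
      U14 = pat u1 u2 ∷ pat o1 o2 ∷ pat u2 u1 ∷ pat o2 o1 ∷ []
      U15 = pat u1 u2 ∷ pat o1 o2 ∷ pat u2 o1 ∷ pat o2 u1 ∷ []
      U16 = pat u1 o2 ∷ pat o1 u2 ∷ pat u2 o1 ∷ pat o2 u1 ∷ []
  in bIs n U14 0
   × bIs n U10 (2 * n) × bIs n U15 (2 * n)
   × bIs n U4 (1 + (n + 1) C 2) × bIs n U5 (1 + (n + 1) C 2)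
   × bIs n U1 (2 ^ n) × bIs n U6 (2 ^ n) × bIs n U7 (2 ^ n)
   × bIs n U12 (2 ^ n) × bIs n U13 (2 ^ n)
   × bIs n U8 (2 * n !) × bIs n U9 (2 * n !) × bIs n U16 (2 * n !)
   × bIs n U3 (sumTo n _!) × bIs n U11 (sumTo n _!)
   × bIs n U2 (n ! + sumBelow n (λ j → j ! * (n ∸ 1 ∸ j) !))
mainTheorem8 n@(suc m@(suc (suc r))) (s≤s (s≤s (s≤s _))) =
    bIs-count U14 (U14-count r)
  , bIs-count U10 (U10-count m) , bIs-count U15 (U15-count m)
  , bIs-count U4 (U4-count n) , bIs-count U5 (U5-count n)
  , bIs-count U1 (U1-count n) , bIs-count U6 (U6-count n) , bIs-count U7 (U7-count n)
  , bIs-count U12 (U12-count n) , bIs-count U13 (U13-count n)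
  , bIs-count U8 (U8-count m) , bIs-count U9 (U9-count m) , bIs-count U16 (U16-count m)
  , bIs-count U3 (U3-count n) , bIs-count U11 (U11-count n)
  , bIs-count U2 (U2-count n)
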